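{- Let $(S,\sqcup,\cap)$ be an ado-semilattice. Then for all $a,b,c\in S$: (1) $a\sqcup b=b\sqcup a$ if and only if $a$ and $b$ have a common upper bound with respect to $\le$; (2) $a\cap((a\cap b)\sqcup c)=a\cap((a\cap c)\sqcup b)$.
   Context: An ado-semilattice is an algebra $(S,\sqcup,\cap)$ such that $(S,\cap)$ is a semilattice and, writing $x\le y$ iff $x=x\cap y$, for all $x,y,z,d$: (i) $x\le x\sqcup y$; (ii) $(x\cap y)\sqcup(y\cap z)\le y$; (iii) $x\sqcup y\le x\sqcup(y\cap(x\sqcup y))$; (iv) $x\cap z\le(x\cap y)\sqcup z$; (v) $(x\cap d)\sqcup((y\cap d)\cap(z\cap d))=((x\cap d)\sqcup(y\cap d))\cap((x\cap d)\sqcup(z\cap d))$; (vi) $\sqcup$ is associative. -}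

module Defs where

open import Level using (Level; suc)
open import Relation.Binary.PropositionalEquality using (_≡_)

record AdoSemilattice (a : Level) : Set (suc a) where
  infixl 6 _⊔_
  infixl 7 _∩_
  infix 4 _≤_
  field
    S   : Set a
    _⊔_ : S → S → S
    _∩_ : S → S → S
    ∩-assoc : ∀ x y z → (x ∩ y) ∩ z ≡ x ∩ (y ∩ z)
    ∩-comm  : ∀ x y → x ∩ y ≡ y ∩ x
    ∩-idem  : ∀ x → x ∩ x ≡ x

  _≤_ : S → S → Set a
  x ≤ y = x ≡ x ∩ y

  field
    ax-i   : ∀ x y → x ≤ x ⊔ y
    ax-ii  : ∀ x y z → (x ∩ y) ⊔ (y ∩ z) ≤ y
    ax-iii : ∀ x y → x ⊔ y ≤ x ⊔ (y ∩ (x ⊔ y))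
    ax-iv  : ∀ x y z → x ∩ z ≤ (x ∩ y) ⊔ z
    ax-v   : ∀ x y z d →
      (x ∩ d) ⊔ ((y ∩ d) ∩ (z ∩ d)) ≡ ((x ∩ d) ⊔ (y ∩ d)) ∩ ((x ∩ d) ⊔ (z ∩ d))
    ⊔-assoc : ∀ x y z → (x ⊔ y) ⊔ z ≡ x ⊔ (y ⊔ z)

-- Below any fixed element w, ⊔ is the least upper bound: axioms (i) and (iv)
-- make x ⊔ y an upper bound of x, y ≤ w, and (ii) makes it the least one. Hence
-- ⊔ commutes exactly on bounded pairs, which is (1). For (2), put d = (a ∩ b) ⊔ c;
-- inside the ideal below d axiom (v) is distributivity of ⊔ over ∩, and it yields
-- a ∩ ((a ∩ b) ⊔ c) ≡ (a ∩ b) ⊔ (a ∩ c), whose right-hand side is symmetric in b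
-- and c by (1), since a bounds both arguments.
module Submission where

open import Defs
open import Level using (Level)
open import Data.Product using (_×_; ∃-syntax; _,_)
open import Function.Bundles using (_⇔_; mk⇔)
open import Relation.Binary.PropositionalEquality
  using (_≡_; sym; trans; cong; cong₂; subst₂; module ≡-Reasoning)

module AdoSemilatticeProperties {ℓ : Level} (A : AdoSemilattice ℓ) where
  open AdoSemilattice A
  open ≡-Reasoning

  ≤-refl : ∀ x → x ≤ x
  ≤-refl x = sym (∩-idem x)

  ≤-antisym : ∀ {x y} → x ≤ y → y ≤ x → x ≡ y
  ≤-antisym {x} {y} x≤y y≤x = trans x≤y (trans (∩-comm x y) (sym y≤x))

  ≤-trans : ∀ {x y z} → x ≤ y → y ≤ z → x ≤ z
  ≤-trans {x} {y} {z} x≤y y≤z = begin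
    x            ≡⟨ x≤y ⟩
    x ∩ y        ≡⟨ cong (x ∩_) y≤z ⟩
    x ∩ (y ∩ z)  ≡⟨ sym (∩-assoc x y z) ⟩
    (x ∩ y) ∩ z  ≡⟨ cong (_∩ z) (sym x≤y) ⟩
    x ∩ z        ∎

  x∩y≤x : ∀ x y → x ∩ y ≤ x
  x∩y≤x x y = sym (begin
    (x ∩ y) ∩ x  ≡⟨ ∩-assoc x y x ⟩
    x ∩ (y ∩ x)  ≡⟨ cong (x ∩_) (∩-comm y x) ⟩
    x ∩ (x ∩ y)  ≡⟨ sym (∩-assoc x x y) ⟩
    (x ∩ x) ∩ y  ≡⟨ cong (_∩ y) (∩-idem x) ⟩
    x ∩ y        ∎)

  x∩y≤y : ∀ x y → x ∩ y ≤ y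
  x∩y≤y x y = sym (trans (∩-assoc x y y) (cong (x ∩_) (∩-idem y)))

  ∩-greatest : ∀ {x y z} → z ≤ x → z ≤ y → z ≤ x ∩ y
  ∩-greatest {x} {y} {z} z≤x z≤y = trans z≤y (trans (cong (_∩ y) z≤x) (∩-assoc z x y))

  x≤y⇒y∩x≡x : ∀ {x y} → x ≤ y → y ∩ x ≡ x
  x≤y⇒y∩x≡x {x} {y} x≤y = trans (∩-comm y x) (sym x≤y)

  ⊔-least : ∀ {x y w} → x ≤ w → y ≤ w → x ⊔ y ≤ w
  ⊔-least {x} {y} {w} x≤w y≤w =
    subst₂ (λ s t → s ⊔ t ≤ w) (sym x≤w) (x≤y⇒y∩x≡x y≤w) (ax-ii x w y)

  y≤x⊔y : ∀ {x y w} → x ≤ w → y ≤ w → y ≤ x ⊔ y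
  y≤x⊔y {x} {y} {w} x≤w y≤w =
    subst₂ (λ s t → s ≤ t ⊔ y) (x≤y⇒y∩x≡x y≤w) (x≤y⇒y∩x≡x x≤w) (ax-iv w x y)

  ⊔-comm-bounded : ∀ {x y w} → x ≤ w → y ≤ w → x ⊔ y ≡ y ⊔ x
  ⊔-comm-bounded {x} {y} x≤w y≤w = ≤-antisym
    (⊔-least (y≤x⊔y y≤w x≤w) (ax-i y x))
    (⊔-least (y≤x⊔y x≤w y≤w) (ax-i x y))

  ⊔-comm⇔bounded : ∀ x y → (x ⊔ y ≡ y ⊔ x) ⇔ (∃[ w ] (x ≤ w × y ≤ w))
  ⊔-comm⇔bounded x y = mk⇔
    (λ comm → x ⊔ y , ax-i x y , trans (ax-i y x) (cong (y ∩_) (sym comm)))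
    (λ { (w , x≤w , y≤w) → ⊔-comm-bounded x≤w y≤w })

  x≤y⇒x⊔y≡y : ∀ {x y} → x ≤ y → x ⊔ y ≡ y
  x≤y⇒x⊔y≡y {x} {y} x≤y = ≤-antisym (⊔-least x≤y (≤-refl y)) (y≤x⊔y x≤y (≤-refl y))

  x⊔y≡x⊔[y∩[x⊔y]] : ∀ x y → x ⊔ y ≡ x ⊔ (y ∩ (x ⊔ y))
  x⊔y≡x⊔[y∩[x⊔y]] x y =
    ≤-antisym (ax-iii x y) (⊔-least (ax-i x y) (x∩y≤y y (x ⊔ y)))

  ⊔-distribˡ-∩-below : ∀ {d x y z} → x ≤ d → y ≤ d → z ≤ d →
                       x ⊔ (y ∩ z) ≡ (x ⊔ y) ∩ (x ⊔ z)
  ⊔-distribˡ-∩-below {d} {x} {y} {z} x≤d y≤d z≤d = begin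
    x ⊔ (y ∩ z)                    ≡⟨ cong₂ _⊔_ x≤d (cong₂ _∩_ y≤d z≤d) ⟩
    (x ∩ d) ⊔ ((y ∩ d) ∩ (z ∩ d))  ≡⟨ ax-v x y z d ⟩
    ((x ∩ d) ⊔ (y ∩ d)) ∩ ((x ∩ d) ⊔ (z ∩ d))
      ≡⟨ sym (cong₂ _∩_ (cong₂ _⊔_ x≤d y≤d) (cong₂ _⊔_ x≤d z≤d)) ⟩
    (x ⊔ y) ∩ (x ⊔ z)  ∎

  [c∩d]∩[a∩d]≡a∩c : ∀ {a c d} → a ∩ c ≤ d → (c ∩ d) ∩ (a ∩ d) ≡ a ∩ c
  [c∩d]∩[a∩d]≡a∩c {a} {c} {d} a∩c≤d = ≤-antisym
    (∩-greatest (≤-trans (x∩y≤y (c ∩ d) (a ∩ d)) (x∩y≤x a d))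
                (≤-trans (x∩y≤x (c ∩ d) (a ∩ d)) (x∩y≤x c d)))
    (∩-greatest (∩-greatest (x∩y≤y a c) a∩c≤d) (∩-greatest (x∩y≤x a c) a∩c≤d))

  ∩-distribˡ-⊔-absorbed : ∀ a b c → a ∩ ((a ∩ b) ⊔ c) ≡ (a ∩ b) ⊔ (a ∩ c)
  ∩-distribˡ-⊔-absorbed a b c = sym (begin
    p ⊔ (a ∩ c)                ≡⟨ cong (p ⊔_) (sym ([c∩d]∩[a∩d]≡a∩c (ax-iv a b c))) ⟩
    p ⊔ ((c ∩ d) ∩ m)          ≡⟨ ⊔-distribˡ-∩-below (ax-i p c) (x∩y≤y c d) m≤d ⟩
    (p ⊔ (c ∩ d)) ∩ (p ⊔ m)    ≡⟨ cong₂ _∩_ (sym (x⊔y≡x⊔[y∩[x⊔y]] p c)) (x≤y⇒x⊔y≡y p≤m) ⟩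
    d ∩ m                      ≡⟨ x≤y⇒y∩x≡x m≤d ⟩
    m                          ∎)
    where
    p = a ∩ b
    d = p ⊔ c
    m = a ∩ d
    m≤d : m ≤ d
    m≤d = x∩y≤y a d
    p≤m : p ≤ m
    p≤m = ∩-greatest (x∩y≤x a b) (ax-i p c)

lemma3p4 : ∀ {ℓ : Level} (A : AdoSemilattice ℓ) → let open AdoSemilattice A in
    ∀ (a b c : S) →
      ((a ⊔ b ≡ b ⊔ a) ⇔ (∃[ u ] (a ≤ u × b ≤ u)))
      × (a ∩ ((a ∩ b) ⊔ c) ≡ a ∩ ((a ∩ c) ⊔ b))
lemma3p4 A a b c = ⊔-comm⇔bounded a b , (begin
  a ∩ ((a ∩ b) ⊔ c)      ≡⟨ ∩-distribˡ-⊔-absorbed a b c ⟩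
  (a ∩ b) ⊔ (a ∩ c)      ≡⟨ ⊔-comm-bounded (x∩y≤x a b) (x∩y≤x a c) ⟩
  (a ∩ c) ⊔ (a ∩ b)      ≡⟨ sym (∩-distribˡ-⊔-absorbed a c b) ⟩
  a ∩ ((a ∩ c) ⊔ b)      ∎)
  where
  open AdoSemilattice A
  open AdoSemilatticeProperties A
  open ≡-Reasoning
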